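{- Let $k\in\mathbb{Z}$. Define the poly-Bell polynomials of the second kind $\mathrm{bel}_n^{(k)}(x)$ ($n\ge1$) by \[ \mathrm{Li}_{k}\big(-x\log(1-t)\big)=\sum_{n=1}^{\infty}\mathrm{bel}_{n}^{(k)}(x)\frac{t^{n}}{n!}. \] Then for every $n\ge1$, \[ x^{n}=\frac{n^{k-1}}{(n-1)!}\sum_{l=1}^{n}(-1)^{n-l}\mathrm{bel}_{l}^{(k)}(x)S_{2}(n,l). \]
   Context: The polylogarithm of index $k\in\mathbb{Z}$ is $\mathrm{Li}_{k}(x)=\sum_{n=1}^{\infty}\frac{x^{n}}{n^{k}}$ (as a formal power series). The Stirling numbers of the second kind are given by $\frac{1}{l!}(e^t-1)^l=\sum_{n\ge l}S_2(n,l)\frac{t^n}{n!}$. -}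

module Defs where

open import Data.Nat using (ℕ; zero; suc; _∸_; _^_; _≡ᵇ_; _!)

open import Data.Integer using (ℤ; +_; -[1+_])
open import Data.Rational using (ℚ; 0ℚ; 1ℚ; _+_; _*_; -_; _/_)
open import Data.Bool using (if_then_else_)

fromℕℚ : ℕ → ℚ
fromℕℚ n = + n / 1

-- 1/n for n ≥ 1 (and 0 for n = 0; only used with n ≥ 1)
recip : ℕ → ℚ
recip zero    = 0ℚ
recip (suc n) = + 1 / suc n

-- m^e for m ≥ 1 and e ∈ ℤ (only used with m ≥ 1)
powZ : ℕ → ℤ → ℚ
powZ m (+ j)     = fromℕℚ (m ^ j)
powZ m -[1+ j ]  = recip (m ^ suc j)

negOnePow : ℕ → ℚ
negOnePow zero    = 1ℚ
negOnePow (suc n) = - negOnePow n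

sumℚ : ℕ → (ℕ → ℚ) → ℚ
sumℚ zero    f = 0ℚ
sumℚ (suc n) f = sumℚ n f + f n

-- Formal power series over ℚ (coefficient sequences); also used as
-- polynomials in x (coefficient of x^j).

Ser : Set
Ser = ℕ → ℚ

zeroS : Ser
zeroS _ = 0ℚ

oneS : Ser
oneS j = if j ≡ᵇ 0 then 1ℚ else 0ℚ

addS : Ser → Ser → Ser
addS a b j = a j + b j

scaleS : ℚ → Ser → Ser
scaleS c a j = c * a j

mulS : Ser → Ser → Ser
mulS a b n = sumℚ (suc n) (λ i → a i * b (n ∸ i))

powS : Ser → ℕ → Ser
powS a zero    = oneS
powS a (suc m) = mulS a (powS a m)

X : Ser
X j = if j ≡ᵇ 1 then 1ℚ else 0ℚ

-- Formal power series in t whose coefficients are polynomials in x.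

PS : Set
PS = ℕ → Ser

mulPS : PS → PS → PS
mulPS a b n = λ j → sumℚ (suc n) (λ i → mulS (a i) (b (n ∸ i)) j)

onePS : PS
onePS n = if n ≡ᵇ 0 then oneS else zeroS

powPS : PS → ℕ → PS
powPS a zero    = onePS
powPS a (suc m) = mulPS a (powPS a m)

-- -x log(1 - t) = Σ_{n ≥ 1} x t^n / n
negXLog1mt : PS
negXLog1mt zero    = zeroS
negXLog1mt (suc n) = scaleS (recip (suc n)) X

-- coefficients of Li_k(y) = Σ_{m ≥ 1} y^m / m^k
liCoeff : ℤ → ℕ → ℚ
liCoeff k zero    = 0ℚ
liCoeff k (suc m) = powZ (suc m) (Data.Integer.- k)

-- formal composition Li_k(y(t)) for y with zero constant term:
-- [t^n] Li_k(y) = Σ_{m=0}^{n} liCoeff k m · [t^n] y^m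
compLi : ℤ → PS → PS
compLi k y n = λ j → sumℚ (suc n) (λ m → liCoeff k m * powPS y m n j)

-- poly-Bell polynomials of the second kind:
-- Li_k(-x log(1-t)) = Σ_{n ≥ 1} bel_n^{(k)}(x) t^n / n!
-- bel k n j = coefficient of x^j in bel_n^{(k)}(x)
bel : ℤ → ℕ → Ser
bel k n = scaleS (fromℕℚ (n !)) (compLi k negXLog1mt n)

-- Stirling numbers of the second kind via
-- (e^t - 1)^l / l! = Σ_{n ≥ l} S2(n,l) t^n / n!

expm1 : Ser
expm1 zero    = 0ℚ
expm1 (suc n) = recip (suc n !)

S2 : ℕ → ℕ → ℚ
S2 n l = fromℕℚ (n !) * (recip (l !) * powS expm1 l n)

-- With L = -log(1 - t) and E = e^t - 1, expanding Li_k(x L) gives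
-- bel_l(x) = l! Σ_m m^(-k) x^m [t^l] L^m, and S2(n,l) = (n!/l!) [t^n] E^l. Hence the
-- alternating sum equals n! Σ_m m^(-k) x^m Σ_l (-1)^(n-l) [t^l] L^m [t^n] E^l, and the inner
-- sum is the Kronecker delta (orthogonality of the two kinds of Stirling numbers). The delta
-- is proved by induction: the differential equations E′ = E + 1 and (1 - t) L′ = 1 give
-- (n + 1) F(n+1, m+1) = (m + 1) F(n, m) for the inner sums F, up to a telescoping remainder.

module Submission where

open import Data.Nat as ℕ using (ℕ; zero; suc; _∸_; _^_; _!; _<_; _≤_; z≤n; s≤s; NonZero)
import Data.Nat.Properties as ℕ
open import Data.Nat.Coprimality as Coprime using (1-coprimeTo)
open import Data.Integer as ℤ using (ℤ; +_; -[1+_]; _-_)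
import Data.Integer.Properties as ℤ
open import Data.Rational using (ℚ; 0ℚ; 1ℚ; _+_; _*_; -_; mkℚ)
open import Data.Rational.Properties
open import Data.Rational.Solver using (module +-*-Solver)
open import Data.Sum using (inj₁; inj₂)
open import Relation.Binary.PropositionalEquality
open +-*-Solver using (solve; _:+_; _:*_; _:=_; con)

open import Defs

fromℕℚ≡mkℚ : ∀ n → fromℕℚ n ≡ mkℚ (+ n) 0 (Coprime.sym (1-coprimeTo n))
fromℕℚ≡mkℚ n = normalize-coprime (Coprime.sym (1-coprimeTo n))

fromℕℚ-+ : ∀ m n → fromℕℚ (m ℕ.+ n) ≡ fromℕℚ m + fromℕℚ n
fromℕℚ-+ m n rewrite fromℕℚ≡mkℚ m | fromℕℚ≡mkℚ n =
  trans (fromℕℚ≡mkℚ (m ℕ.+ n))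
    (sym (trans (/-cong {q₁ = 1} {q₂ = 1} (cong₂ ℤ._+_ (ℤ.*-identityʳ (+ m)) (ℤ.*-identityʳ (+ n))) refl)
                  (fromℕℚ≡mkℚ (m ℕ.+ n))))

fromℕℚ-* : ∀ m n → fromℕℚ (m ℕ.* n) ≡ fromℕℚ m * fromℕℚ n
fromℕℚ-* m n rewrite fromℕℚ≡mkℚ m | fromℕℚ≡mkℚ n =
  trans (fromℕℚ≡mkℚ (m ℕ.* n))
    (sym (trans (/-cong {q₁ = 1} {q₂ = 1} (sym (ℤ.pos-* m n)) refl) (fromℕℚ≡mkℚ (m ℕ.* n))))

fromℕℚ*recip : ∀ n .{{_ : NonZero n}} → fromℕℚ n * recip n ≡ 1ℚ
fromℕℚ*recip (suc n) rewrite fromℕℚ≡mkℚ (suc n) | normalize-coprime (1-coprimeTo (suc n)) =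
  *-inverseʳ (mkℚ (+ suc n) 0 (Coprime.sym (1-coprimeTo (suc n))))

recip*fromℕℚ : ∀ n .{{_ : NonZero n}} → recip n * fromℕℚ n ≡ 1ℚ
recip*fromℕℚ n = trans (*-comm (recip n) (fromℕℚ n)) (fromℕℚ*recip n)

fromℕℚ-cancelˡ : ∀ n .{{_ : NonZero n}} {p q} → fromℕℚ n * p ≡ fromℕℚ n * q → p ≡ q
fromℕℚ-cancelˡ n {p} {q} eq = begin
  p                        ≡⟨ sym (recip*fromℕℚ*-cancel p) ⟩
  recip n * (fromℕℚ n * p) ≡⟨ cong (recip n *_) eq ⟩
  recip n * (fromℕℚ n * q) ≡⟨ recip*fromℕℚ*-cancel q ⟩
  q                        ∎
  where
  open ≡-Reasoning
  recip*fromℕℚ*-cancel : ∀ r → recip n * (fromℕℚ n * r) ≡ r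
  recip*fromℕℚ*-cancel r = trans (sym (*-assoc (recip n) (fromℕℚ n) r))
                                 (trans (cong (_* r) (recip*fromℕℚ n)) (*-identityˡ r))

fromℕℚ*recip[*] : ∀ m n .{{_ : NonZero m}} .{{_ : NonZero n}} →
                  fromℕℚ m * recip (m ℕ.* n) ≡ recip n
fromℕℚ*recip[*] m n = fromℕℚ-cancelˡ n (begin
  fromℕℚ n * (fromℕℚ m * recip (m ℕ.* n))   ≡⟨ solve 3 (λ a b c → a :* (b :* c) := b :* a :* c) refl (fromℕℚ n) (fromℕℚ m) _ ⟩
  fromℕℚ m * fromℕℚ n * recip (m ℕ.* n)     ≡⟨ cong (_* recip (m ℕ.* n)) (sym (fromℕℚ-* m n)) ⟩
  fromℕℚ (m ℕ.* n) * recip (m ℕ.* n)        ≡⟨ fromℕℚ*recip (m ℕ.* n) {{ℕ.m*n≢0 m n}} ⟩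
  1ℚ                                       ≡⟨ sym (fromℕℚ*recip n) ⟩
  fromℕℚ n * recip n                        ∎)
  where open ≡-Reasoning

fromℕℚ*fromℕℚ[^]*recip[^suc] : ∀ m a .{{_ : NonZero m}} →
                               fromℕℚ m * fromℕℚ (m ^ a) * recip (m ^ suc a) ≡ 1ℚ
fromℕℚ*fromℕℚ[^]*recip[^suc] m a =
  trans (cong (_* recip (m ^ suc a)) (sym (fromℕℚ-* m (m ^ a))))
        (fromℕℚ*recip (m ^ suc a) {{ℕ.m^n≢0 m (suc a)}})

powZ-pred*powZ-neg*base : ∀ m k .{{_ : NonZero m}} →
                          powZ m (k - + 1) * powZ m (ℤ.- k) * fromℕℚ m ≡ 1ℚ
powZ-pred*powZ-neg*base m (+ zero) =
  trans (solve 3 (λ r p b → r :* p :* b := b :* p :* r) refl (recip (m ^ 1)) (fromℕℚ (m ^ 0)) (fromℕℚ m))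
        (fromℕℚ*fromℕℚ[^]*recip[^suc] m 0)
powZ-pred*powZ-neg*base m (+ suc a) =
  trans (solve 3 (λ p r b → p :* r :* b := b :* p :* r) refl (fromℕℚ (m ^ a)) (recip (m ^ suc a)) (fromℕℚ m))
        (fromℕℚ*fromℕℚ[^]*recip[^suc] m a)
powZ-pred*powZ-neg*base m -[1+ a ] rewrite ℕ.+-identityʳ a =
  trans (solve 3 (λ r p b → r :* p :* b := b :* p :* r) refl (recip (m ^ suc (suc a))) (fromℕℚ (m ^ suc a)) (fromℕℚ m))
        (fromℕℚ*fromℕℚ[^]*recip[^suc] m (suc a))

sumℚ-cong-< : ∀ n {f g : ℕ → ℚ} → (∀ i → i < n → f i ≡ g i) → sumℚ n f ≡ sumℚ n g
sumℚ-cong-< zero    eq = refl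
sumℚ-cong-< (suc n) eq = cong₂ _+_ (sumℚ-cong-< n (λ i i<n → eq i (ℕ.m<n⇒m<1+n i<n))) (eq n (ℕ.n<1+n n))

sumℚ-cong : ∀ n {f g : ℕ → ℚ} → f ≗ g → sumℚ n f ≡ sumℚ n g
sumℚ-cong n eq = sumℚ-cong-< n (λ i _ → eq i)

sumℚ-zero : ∀ n {f : ℕ → ℚ} → (∀ i → i < n → f i ≡ 0ℚ) → sumℚ n f ≡ 0ℚ
sumℚ-zero zero    eq = refl
sumℚ-zero (suc n) eq = trans (cong₂ _+_ (sumℚ-zero n (λ i i<n → eq i (ℕ.m<n⇒m<1+n i<n))) (eq n (ℕ.n<1+n n)))
                             (+-identityˡ 0ℚ)

sumℚ-+ : ∀ n (f g : ℕ → ℚ) → sumℚ n (λ i → f i + g i) ≡ sumℚ n f + sumℚ n g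
sumℚ-+ zero    f g = refl
sumℚ-+ (suc n) f g = trans (cong (_+ (f n + g n)) (sumℚ-+ n f g))
  (solve 4 (λ a b c d → (a :+ b) :+ (c :+ d) := (a :+ c) :+ (b :+ d)) refl (sumℚ n f) (sumℚ n g) (f n) (g n))

sumℚ-neg : ∀ n (f : ℕ → ℚ) → sumℚ n (λ i → - f i) ≡ - sumℚ n f
sumℚ-neg zero    f = refl
sumℚ-neg (suc n) f = trans (cong (_+ - f n) (sumℚ-neg n f)) (sym (neg-distrib-+ (sumℚ n f) (f n)))

*-sumℚ : ∀ n c (f : ℕ → ℚ) → c * sumℚ n f ≡ sumℚ n (λ i → c * f i)
*-sumℚ zero    c f = *-zeroʳ c
*-sumℚ (suc n) c f = trans (*-distribˡ-+ c _ _) (cong (_+ c * f n) (*-sumℚ n c f))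

sumℚ-* : ∀ n c (f : ℕ → ℚ) → sumℚ n f * c ≡ sumℚ n (λ i → f i * c)
sumℚ-* n c f = trans (*-comm _ c) (trans (*-sumℚ n c f) (sumℚ-cong n (λ i → *-comm c (f i))))

sumℚ-suc : ∀ n (f : ℕ → ℚ) → sumℚ (suc n) f ≡ f 0 + sumℚ n (λ i → f (suc i))
sumℚ-suc zero    f = trans (+-identityˡ (f 0)) (sym (+-identityʳ (f 0)))
sumℚ-suc (suc n) f = trans (cong (_+ f (suc n)) (sumℚ-suc n f))
                           (+-assoc (f 0) (sumℚ n (λ i → f (suc i))) (f (suc n)))

sumℚ-comm : ∀ m n (f : ℕ → ℕ → ℚ) →
            sumℚ m (λ i → sumℚ n (f i)) ≡ sumℚ n (λ j → sumℚ m (λ i → f i j))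
sumℚ-comm zero    n f = sym (sumℚ-zero n (λ _ _ → refl))
sumℚ-comm (suc m) n f = trans (cong (_+ sumℚ n (f m)) (sumℚ-comm m n f))
                              (sym (sumℚ-+ n (λ j → sumℚ m (λ i → f i j)) (f m)))

sumℚ-extend : ∀ m n (f : ℕ → ℚ) → (∀ i → m ≤ i → i < n → f i ≡ 0ℚ) → m ≤ n → sumℚ m f ≡ sumℚ n f
sumℚ-extend m zero    f eq z≤n = refl
sumℚ-extend m (suc n) f eq m≤1+n with ℕ.m≤n⇒m<n∨m≡n m≤1+n
... | inj₂ refl       = refl
... | inj₁ (s≤s m≤n) = trans (sym (+-identityʳ (sumℚ m f)))
  (cong₂ _+_ (sumℚ-extend m n f (λ i m≤i i<n → eq i m≤i (ℕ.m<n⇒m<1+n i<n)) m≤n)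
             (sym (eq n m≤n (ℕ.n<1+n n))))

m<n⇒n∸m≡1+[n∸1+m] : ∀ {m n} → m < n → n ∸ m ≡ suc (n ∸ suc m)
m<n⇒n∸m≡1+[n∸1+m] {zero}  {suc n} _         = refl
m<n⇒n∸m≡1+[n∸1+m] {suc m} {suc n} (s≤s m<n) = m<n⇒n∸m≡1+[n∸1+m] m<n

kronecker : ℕ → ℕ → ℚ
kronecker zero    zero    = 1ℚ
kronecker zero    (suc m) = 0ℚ
kronecker (suc n) zero    = 0ℚ
kronecker (suc n) (suc m) = kronecker n m

kronecker-diag : ∀ n → kronecker n n ≡ 1ℚ
kronecker-diag zero    = refl
kronecker-diag (suc n) = kronecker-diag n

kronecker-< : ∀ {m n} → m < n → kronecker n m ≡ 0ℚ
kronecker-< {zero}  {suc n} _         = refl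
kronecker-< {suc m} {suc n} (s≤s m<n) = kronecker-< m<n

sumℚ-kronecker : ∀ n (f : ℕ → ℚ) → sumℚ (suc n) (λ m → f m * kronecker n m) ≡ f n
sumℚ-kronecker n f = begin
  sumℚ n (λ m → f m * kronecker n m) + f n * kronecker n n
    ≡⟨ cong₂ _+_ (sumℚ-zero n (λ m m<n → trans (cong (f m *_) (kronecker-< m<n)) (*-zeroʳ (f m))))
                 (cong (f n *_) (kronecker-diag n)) ⟩
  0ℚ + f n * 1ℚ ≡⟨ trans (+-identityˡ _) (*-identityʳ (f n)) ⟩
  f n           ∎
  where open ≡-Reasoning

sumℚ-alternating-telescope : ∀ n (g : ℕ → ℚ) → g 0 ≡ 0ℚ → g (suc n) ≡ 0ℚ →
  sumℚ (suc n) (λ l → negOnePow (n ∸ l) * (g l + g (suc l))) ≡ 0ℚ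
sumℚ-alternating-telescope n g g0≡0 g[1+n]≡0 = begin
  sumℚ (suc n) (λ l → negOnePow (n ∸ l) * (g l + g (suc l)))
    ≡⟨ sumℚ-cong (suc n) (λ l → *-distribˡ-+ (negOnePow (n ∸ l)) (g l) (g (suc l))) ⟩
  sumℚ (suc n) (λ l → negOnePow (n ∸ l) * g l + negOnePow (n ∸ l) * g (suc l))
    ≡⟨ sumℚ-+ (suc n) _ _ ⟩
  sumℚ (suc n) (λ l → negOnePow (n ∸ l) * g l) + sumℚ (suc n) (λ l → negOnePow (n ∸ l) * g (suc l))
    ≡⟨ cong₂ _+_ lower-terms upper-terms ⟩
  S + - S ≡⟨ +-inverseʳ S ⟩
  0ℚ      ∎
  where
  open ≡-Reasoning
  S = sumℚ n (λ l → negOnePow (n ∸ suc l) * g (suc l))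
  lower-terms : sumℚ (suc n) (λ l → negOnePow (n ∸ l) * g l) ≡ S
  lower-terms = begin
    sumℚ (suc n) (λ l → negOnePow (n ∸ l) * g l)  ≡⟨ sumℚ-suc n _ ⟩
    negOnePow n * g 0 + S                         ≡⟨ cong (λ x → negOnePow n * x + S) g0≡0 ⟩
    negOnePow n * 0ℚ + S                          ≡⟨ cong (_+ S) (*-zeroʳ (negOnePow n)) ⟩
    0ℚ + S                                        ≡⟨ +-identityˡ S ⟩
    S                                             ∎
  upper-terms : sumℚ (suc n) (λ l → negOnePow (n ∸ l) * g (suc l)) ≡ - S
  upper-terms = begin
    sumℚ n (λ l → negOnePow (n ∸ l) * g (suc l)) + negOnePow (n ∸ n) * g (suc n)
      ≡⟨ cong₂ _+_ (sumℚ-cong-< n (λ l l<n → cong (λ e → negOnePow e * g (suc l)) (m<n⇒n∸m≡1+[n∸1+m] l<n)))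
                   (trans (cong (negOnePow (n ∸ n) *_) g[1+n]≡0) (*-zeroʳ (negOnePow (n ∸ n)))) ⟩
    sumℚ n (λ l → - negOnePow (n ∸ suc l) * g (suc l)) + 0ℚ
      ≡⟨ +-identityʳ _ ⟩
    sumℚ n (λ l → - negOnePow (n ∸ suc l) * g (suc l))
      ≡⟨ sumℚ-cong n (λ l → sym (neg-distribˡ-* (negOnePow (n ∸ suc l)) (g (suc l)))) ⟩
    sumℚ n (λ l → - (negOnePow (n ∸ suc l) * g (suc l)))
      ≡⟨ sumℚ-neg n _ ⟩
    - S ∎

deriv : Ser → Ser
deriv a n = fromℕℚ (suc n) * a (suc n)

shiftS : Ser → Ser
shiftS a zero    = 0ℚ
shiftS a (suc n) = a n

shiftS-cong : ∀ {a b} → a ≗ b → shiftS a ≗ shiftS b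
shiftS-cong eq zero    = refl
shiftS-cong eq (suc n) = eq n

shiftS-addS : ∀ a b → shiftS (addS a b) ≗ addS (shiftS a) (shiftS b)
shiftS-addS a b zero    = sym (+-identityˡ 0ℚ)
shiftS-addS a b (suc n) = refl

mulS-congˡ : ∀ {a a′} → a ≗ a′ → ∀ b → mulS a b ≗ mulS a′ b
mulS-congˡ eq b n = sumℚ-cong (suc n) (λ i → cong (_* b (n ∸ i)) (eq i))

mulS-congʳ : ∀ a {b b′} → b ≗ b′ → mulS a b ≗ mulS a b′
mulS-congʳ a eq n = sumℚ-cong (suc n) (λ i → cong (a i *_) (eq (n ∸ i)))

mulS-identityˡ : ∀ a → mulS oneS a ≗ a
mulS-identityˡ a n = begin
  mulS oneS a n                                 ≡⟨ sumℚ-suc n (λ i → oneS i * a (n ∸ i)) ⟩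
  1ℚ * a n + sumℚ n (λ i → 0ℚ * a (n ∸ suc i))  ≡⟨ cong₂ _+_ (*-identityˡ (a n)) (sumℚ-zero n (λ i _ → *-zeroˡ (a (n ∸ suc i)))) ⟩
  a n + 0ℚ                                      ≡⟨ +-identityʳ (a n) ⟩
  a n                                           ∎
  where open ≡-Reasoning

mulS-identityʳ : ∀ a → mulS a oneS ≗ a
mulS-identityʳ a n = begin
  sumℚ n (λ i → a i * oneS (n ∸ i)) + a n * oneS (n ∸ n)
    ≡⟨ cong₂ _+_ (sumℚ-zero n (λ i i<n → trans (cong (λ e → a i * oneS e) (m<n⇒n∸m≡1+[n∸1+m] i<n)) (*-zeroʳ (a i))))
                 (cong (λ e → a n * oneS e) (ℕ.n∸n≡0 n)) ⟩
  0ℚ + a n * 1ℚ ≡⟨ trans (+-identityˡ _) (*-identityʳ (a n)) ⟩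
  a n           ∎
  where open ≡-Reasoning

mulS-zeroʳ : ∀ a → mulS a zeroS ≗ zeroS
mulS-zeroʳ a n = sumℚ-zero (suc n) (λ i _ → *-zeroʳ (a i))

mulS-distribˡ-addS : ∀ a b c → mulS a (addS b c) ≗ addS (mulS a b) (mulS a c)
mulS-distribˡ-addS a b c n =
  trans (sumℚ-cong (suc n) (λ i → *-distribˡ-+ (a i) (b (n ∸ i)) (c (n ∸ i)))) (sumℚ-+ (suc n) _ _)

mulS-distribʳ-addS : ∀ a b c → mulS (addS a b) c ≗ addS (mulS a c) (mulS b c)
mulS-distribʳ-addS a b c n =
  trans (sumℚ-cong (suc n) (λ i → *-distribʳ-+ (c (n ∸ i)) (a i) (b i))) (sumℚ-+ (suc n) _ _)

mulS-scaleSʳ : ∀ a c b → mulS a (scaleS c b) ≗ scaleS c (mulS a b)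
mulS-scaleSʳ a c b n = sym (trans (*-sumℚ (suc n) c (λ i → a i * b (n ∸ i)))
  (sumℚ-cong (suc n) (λ i → solve 3 (λ c x y → c :* (x :* y) := x :* (c :* y)) refl c (a i) (b (n ∸ i)))))

mulS-shiftSˡ : ∀ a b → mulS (shiftS a) b ≗ shiftS (mulS a b)
mulS-shiftSˡ a b zero    = trans (+-identityˡ _) (*-zeroˡ (b 0))
mulS-shiftSˡ a b (suc n) = trans (sumℚ-suc (suc n) (λ i → shiftS a i * b (suc n ∸ i)))
  (trans (cong (_+ mulS a b n) (*-zeroˡ (b (suc n)))) (+-identityˡ _))

mulS-shiftSʳ : ∀ a b → mulS a (shiftS b) ≗ shiftS (mulS a b)
mulS-shiftSʳ a b zero    = trans (+-identityˡ _) (*-zeroʳ (a 0))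
mulS-shiftSʳ a b (suc n) = begin
  sumℚ (suc n) (λ i → a i * shiftS b (suc n ∸ i)) + a (suc n) * shiftS b (suc n ∸ suc n)
    ≡⟨ cong₂ _+_ (sumℚ-cong-< (suc n) (λ i i<1+n → cong (λ e → a i * shiftS b e) (m<n⇒n∸m≡1+[n∸1+m] i<1+n)))
                 (trans (cong (λ e → a (suc n) * shiftS b e) (ℕ.n∸n≡0 n)) (*-zeroʳ (a (suc n)))) ⟩
  mulS a b n + 0ℚ ≡⟨ +-identityʳ _ ⟩
  mulS a b n      ∎
  where open ≡-Reasoning

powS-vanishes-below : ∀ a → a 0 ≡ 0ℚ → ∀ {l n} → n < l → powS a l n ≡ 0ℚ
powS-vanishes-below a a0≡0 {suc l} {zero} _ =
  trans (+-identityˡ _) (trans (cong (_* powS a l 0) a0≡0) (*-zeroˡ (powS a l 0)))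
powS-vanishes-below a a0≡0 {suc l} {suc n} (s≤s n<l) = begin
  mulS a (powS a l) (suc n)
    ≡⟨ sumℚ-suc (suc n) (λ i → a i * powS a l (suc n ∸ i)) ⟩
  a 0 * powS a l (suc n) + sumℚ (suc n) (λ i → a (suc i) * powS a l (n ∸ i))
    ≡⟨ cong₂ _+_ (trans (cong (_* powS a l (suc n)) a0≡0) (*-zeroˡ (powS a l (suc n))))
                 (sumℚ-zero (suc n) (λ i _ → trans (cong (a (suc i) *_) (powS-vanishes-below a a0≡0 (ℕ.≤-<-trans (ℕ.m∸n≤m n i) n<l)))
                                                   (*-zeroʳ (a (suc i))))) ⟩
  0ℚ + 0ℚ ≡⟨ +-identityʳ 0ℚ ⟩
  0ℚ      ∎
  where open ≡-Reasoning

-- Split the weight n + 1 of the term a_i b_(n+1-i) as i + (n + 1 - i).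
deriv-mulS : ∀ a b → deriv (mulS a b) ≗ addS (mulS (deriv a) b) (mulS a (deriv b))
deriv-mulS a b n = begin
  fromℕℚ (suc n) * sumℚ (2+ n) t
    ≡⟨ *-sumℚ (2+ n) (fromℕℚ (suc n)) t ⟩
  sumℚ (2+ n) (λ i → fromℕℚ (suc n) * t i)
    ≡⟨ sumℚ-cong-< (2+ n) split ⟩
  sumℚ (2+ n) (λ i → fromℕℚ i * t i + fromℕℚ (suc n ∸ i) * t i)
    ≡⟨ sumℚ-+ (2+ n) _ _ ⟩
  sumℚ (2+ n) (λ i → fromℕℚ i * t i) + sumℚ (2+ n) (λ i → fromℕℚ (suc n ∸ i) * t i)
    ≡⟨ cong₂ _+_ left right ⟩
  mulS (deriv a) b n + mulS a (deriv b) n ∎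
  where
  open ≡-Reasoning
  2+ : ℕ → ℕ
  2+ n = suc (suc n)
  t : ℕ → ℚ
  t i = a i * b (suc n ∸ i)
  split : ∀ i → i < 2+ n → fromℕℚ (suc n) * t i ≡ fromℕℚ i * t i + fromℕℚ (suc n ∸ i) * t i
  split i (s≤s i≤1+n) = begin
    fromℕℚ (suc n) * t i                           ≡⟨ cong (λ m → fromℕℚ m * t i) (sym (ℕ.m+[n∸m]≡n i≤1+n)) ⟩
    fromℕℚ (i ℕ.+ (suc n ∸ i)) * t i               ≡⟨ cong (_* t i) (fromℕℚ-+ i (suc n ∸ i)) ⟩
    (fromℕℚ i + fromℕℚ (suc n ∸ i)) * t i          ≡⟨ *-distribʳ-+ (t i) (fromℕℚ i) (fromℕℚ (suc n ∸ i)) ⟩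
    fromℕℚ i * t i + fromℕℚ (suc n ∸ i) * t i      ∎
  left : sumℚ (2+ n) (λ i → fromℕℚ i * t i) ≡ mulS (deriv a) b n
  left = begin
    sumℚ (2+ n) (λ i → fromℕℚ i * t i)
      ≡⟨ sumℚ-suc (suc n) (λ i → fromℕℚ i * t i) ⟩
    0ℚ * t 0 + sumℚ (suc n) (λ i → fromℕℚ (suc i) * (a (suc i) * b (n ∸ i)))
      ≡⟨ cong₂ _+_ (*-zeroˡ (t 0)) (sumℚ-cong (suc n) (λ i → sym (*-assoc (fromℕℚ (suc i)) (a (suc i)) (b (n ∸ i))))) ⟩
    0ℚ + mulS (deriv a) b n
      ≡⟨ +-identityˡ _ ⟩
    mulS (deriv a) b n ∎
  right-term : ∀ i → i < suc n → fromℕℚ (suc n ∸ i) * t i ≡ a i * deriv b (n ∸ i)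
  right-term i i<1+n rewrite m<n⇒n∸m≡1+[n∸1+m] i<1+n =
    solve 3 (λ x y z → x :* (y :* z) := y :* (x :* z)) refl (fromℕℚ (suc (n ∸ i))) (a i) (b (suc (n ∸ i)))
  right : sumℚ (2+ n) (λ i → fromℕℚ (suc n ∸ i) * t i) ≡ mulS a (deriv b) n
  right = begin
    sumℚ (suc n) (λ i → fromℕℚ (suc n ∸ i) * t i) + fromℕℚ (suc n ∸ suc n) * t (suc n)
      ≡⟨ cong₂ _+_ (sumℚ-cong-< (suc n) right-term)
                   (trans (cong (λ m → fromℕℚ m * t (suc n)) (ℕ.n∸n≡0 n)) (*-zeroˡ (t (suc n)))) ⟩
    mulS a (deriv b) n + 0ℚ
      ≡⟨ +-identityʳ _ ⟩
    mulS a (deriv b) n ∎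

deriv-oneS : deriv oneS ≗ zeroS
deriv-oneS n = *-zeroʳ (fromℕℚ (suc n))

deriv-mulS-oneS : ∀ a → deriv (mulS a oneS) ≗ deriv a
deriv-mulS-oneS a n = begin
  deriv (mulS a oneS) n                             ≡⟨ deriv-mulS a oneS n ⟩
  mulS (deriv a) oneS n + mulS a (deriv oneS) n     ≡⟨ cong₂ _+_ (mulS-identityʳ (deriv a) n)
                                                              (trans (mulS-congʳ a deriv-oneS n) (mulS-zeroʳ a n)) ⟩
  deriv a n + 0ℚ                                    ≡⟨ +-identityʳ (deriv a n) ⟩
  deriv a n                                         ∎
  where open ≡-Reasoning

deriv-expm1 : deriv expm1 ≗ addS expm1 oneS
deriv-expm1 zero    = refl
deriv-expm1 (suc n) = begin
  fromℕℚ (2 ℕ.+ n) * recip ((2 ℕ.+ n) ℕ.* suc n !) ≡⟨ fromℕℚ*recip[*] (2 ℕ.+ n) (suc n !) {{_}} {{suc n ℕ.!≢0}} ⟩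
  recip (suc n !)                                   ≡⟨ sym (+-identityʳ (recip (suc n !))) ⟩
  recip (suc n !) + 0ℚ                              ∎
  where open ≡-Reasoning

deriv-powS-expm1 : ∀ l → deriv (powS expm1 (suc l)) ≗
                         scaleS (fromℕℚ (suc l)) (addS (powS expm1 (suc l)) (powS expm1 l))
deriv-powS-expm1 zero n = begin
  deriv (mulS expm1 oneS) n         ≡⟨ deriv-mulS-oneS expm1 n ⟩
  deriv expm1 n                     ≡⟨ deriv-expm1 n ⟩
  expm1 n + oneS n                  ≡⟨ cong (_+ oneS n) (sym (mulS-identityʳ expm1 n)) ⟩
  mulS expm1 oneS n + oneS n        ≡⟨ sym (*-identityˡ _) ⟩
  1ℚ * (mulS expm1 oneS n + oneS n) ∎
  where open ≡-Reasoning
deriv-powS-expm1 (suc l) n = begin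
  deriv (mulS expm1 P) n
    ≡⟨ deriv-mulS expm1 P n ⟩
  mulS (deriv expm1) P n + mulS expm1 (deriv P) n
    ≡⟨ cong₂ _+_ (mulS-congˡ deriv-expm1 P n) (mulS-congʳ expm1 (deriv-powS-expm1 l) n) ⟩
  mulS (addS expm1 oneS) P n + mulS expm1 (scaleS c (addS P Q)) n
    ≡⟨ cong₂ _+_ (mulS-distribʳ-addS expm1 oneS P n) (mulS-scaleSʳ expm1 c (addS P Q) n) ⟩
  (mulS expm1 P n + mulS oneS P n) + c * mulS expm1 (addS P Q) n
    ≡⟨ cong₂ (λ x y → (mulS expm1 P n + x) + c * y) (mulS-identityˡ P n) (mulS-distribˡ-addS expm1 P Q n) ⟩
  (mulS expm1 P n + P n) + c * (mulS expm1 P n + P n)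
    ≡⟨ solve 3 (λ x y c → (x :+ y) :+ c :* (x :+ y) := (con 1ℚ :+ c) :* (x :+ y)) refl (mulS expm1 P n) (P n) c ⟩
  (1ℚ + c) * (mulS expm1 P n + P n)
    ≡⟨ cong (_* (mulS expm1 P n + P n)) (sym (fromℕℚ-+ 1 (suc l))) ⟩
  fromℕℚ (2 ℕ.+ l) * (mulS expm1 P n + P n) ∎
  where
  open ≡-Reasoning
  P = powS expm1 (suc l)
  Q = powS expm1 l
  c = fromℕℚ (suc l)

negLog1mt : Ser
negLog1mt zero    = 0ℚ
negLog1mt (suc n) = recip (suc n)

deriv-negLog1mt : deriv negLog1mt ≗ addS oneS (shiftS (deriv negLog1mt))
deriv-negLog1mt zero    = trans (fromℕℚ*recip 1) (sym (+-identityʳ 1ℚ))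
deriv-negLog1mt (suc n) = begin
  fromℕℚ (2 ℕ.+ n) * recip (2 ℕ.+ n) ≡⟨ fromℕℚ*recip (2 ℕ.+ n) ⟩
  1ℚ                                 ≡⟨ sym (fromℕℚ*recip (suc n)) ⟩
  deriv negLog1mt n                  ≡⟨ sym (+-identityˡ _) ⟩
  0ℚ + deriv negLog1mt n             ∎
  where open ≡-Reasoning

-- (1 - t) (L^(m+1))′ = (m + 1) L^m, written without subtraction.
deriv-powS-negLog1mt : ∀ m → deriv (powS negLog1mt (suc m)) ≗
  addS (scaleS (fromℕℚ (suc m)) (powS negLog1mt m)) (shiftS (deriv (powS negLog1mt (suc m))))
deriv-powS-negLog1mt zero n = begin
  deriv (mulS L oneS) n                 ≡⟨ deriv-mulS-oneS L n ⟩
  deriv L n                             ≡⟨ deriv-negLog1mt n ⟩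
  oneS n + shiftS (deriv L) n           ≡⟨ cong₂ _+_ (sym (*-identityˡ (oneS n)))
                                                    (shiftS-cong (λ i → sym (deriv-mulS-oneS L i)) n) ⟩
  1ℚ * oneS n + shiftS (deriv (mulS L oneS)) n ∎
  where
  open ≡-Reasoning
  L = negLog1mt
deriv-powS-negLog1mt (suc m) n = begin
  deriv (mulS L P) n
    ≡⟨ deriv-mulS L P n ⟩
  mulS (deriv L) P n + mulS L (deriv P) n
    ≡⟨ cong₂ _+_ (mulS-congˡ deriv-negLog1mt P n) (mulS-congʳ L (deriv-powS-negLog1mt m) n) ⟩
  mulS (addS oneS (shiftS (deriv L))) P n + mulS L (addS (scaleS c Q) (shiftS (deriv P))) n
    ≡⟨ cong₂ _+_ (mulS-distribʳ-addS oneS (shiftS (deriv L)) P n) (mulS-distribˡ-addS L (scaleS c Q) (shiftS (deriv P)) n) ⟩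
  (mulS oneS P n + mulS (shiftS (deriv L)) P n) + (mulS L (scaleS c Q) n + mulS L (shiftS (deriv P)) n)
    ≡⟨ cong₂ _+_ (cong₂ _+_ (mulS-identityˡ P n) (mulS-shiftSˡ (deriv L) P n))
                 (cong₂ _+_ (mulS-scaleSʳ L c Q n) (mulS-shiftSʳ L (deriv P) n)) ⟩
  (P n + shiftS A n) + (c * P n + shiftS B n)
    ≡⟨ solve 4 (λ p x c y → (p :+ x) :+ (c :* p :+ y) := (con 1ℚ :+ c) :* p :+ (x :+ y)) refl (P n) (shiftS A n) c (shiftS B n) ⟩
  (1ℚ + c) * P n + (shiftS A n + shiftS B n)
    ≡⟨ cong₂ _+_ (cong (_* P n) (sym (fromℕℚ-+ 1 (suc m))))
                 (sym (trans (shiftS-cong (deriv-mulS L P) n) (shiftS-addS A B n))) ⟩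
  fromℕℚ (2 ℕ.+ m) * P n + shiftS (deriv (mulS L P)) n ∎
  where
  open ≡-Reasoning
  L = negLog1mt
  P = powS L (suc m)
  Q = powS L m
  c = fromℕℚ (suc m)
  A = mulS (deriv L) P
  B = mulS L (deriv P)

powS-negLog1mt-recurrence : ∀ l m →
  fromℕℚ (suc l) * powS negLog1mt (suc m) (suc l)
    ≡ fromℕℚ (suc m) * powS negLog1mt m l + fromℕℚ l * powS negLog1mt (suc m) l
powS-negLog1mt-recurrence zero m =
  trans (deriv-powS-negLog1mt m 0) (cong (λ x → fromℕℚ (suc m) * powS negLog1mt m 0 + x) (sym (*-zeroˡ (powS negLog1mt (suc m) 0))))
powS-negLog1mt-recurrence (suc l) m = deriv-powS-negLog1mt m (suc l)

kronecker-subst : ∀ (f : ℕ → ℚ) n m → f m * kronecker n m ≡ f n * kronecker n m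
kronecker-subst f zero    zero    = refl
kronecker-subst f zero    (suc m) = trans (*-zeroʳ (f (suc m))) (sym (*-zeroʳ (f 0)))
kronecker-subst f (suc n) zero    = trans (*-zeroʳ (f 0)) (sym (*-zeroʳ (f (suc n))))
kronecker-subst f (suc n) (suc m) = kronecker-subst (λ i → f (suc i)) n m

-- Since [t^l] L^m = (m!/l!) |s(l,m)| and [t^n] (e^t - 1)^l = (l!/n!) S(n,l), this is
-- (m!/n!) Σ_l (-1)^(n-l) |s(l,m)| S(n,l).
stirlingPairing : ℕ → ℕ → ℚ
stirlingPairing n m = sumℚ (suc n) (λ l → negOnePow (n ∸ l) * powS negLog1mt m l * powS expm1 l n)

powS-negLog1mt-0 : ∀ m → powS negLog1mt (suc m) 0 ≡ 0ℚ
powS-negLog1mt-0 m = powS-vanishes-below negLog1mt refl {suc m} (s≤s z≤n)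

stirlingPairing-suc : ∀ n m →
  fromℕℚ (suc n) * stirlingPairing (suc n) (suc m) ≡ fromℕℚ (suc m) * stirlingPairing n m
stirlingPairing-suc n m = begin
  N * stirlingPairing (suc n) M
    ≡⟨ *-sumℚ (suc (suc n)) N _ ⟩
  sumℚ (suc (suc n)) (λ l → N * (s (suc n ∸ l) * c l M * powS E l (suc n)))
    ≡⟨ sumℚ-suc (suc n) _ ⟩
  N * (s (suc n) * c 0 M * powS E 0 (suc n)) + sumℚ (suc n) (λ l → N * (s (n ∸ l) * c (suc l) M * powS E (suc l) (suc n)))
    ≡⟨ cong₂ _+_ first-term-vanishes (sumℚ-cong (suc n) term) ⟩
  0ℚ + sumℚ (suc n) (λ l → fromℕℚ (suc m) * (s (n ∸ l) * c l m * powS E l n) + s (n ∸ l) * (g l + g (suc l)))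
    ≡⟨ trans (+-identityˡ _) (sumℚ-+ (suc n) _ _) ⟩
  sumℚ (suc n) (λ l → fromℕℚ (suc m) * (s (n ∸ l) * c l m * powS E l n)) + sumℚ (suc n) (λ l → s (n ∸ l) * (g l + g (suc l)))
    ≡⟨ cong₂ _+_ (sym (*-sumℚ (suc n) (fromℕℚ (suc m)) _))
                 (sumℚ-alternating-telescope n g g0≡0 g[1+n]≡0) ⟩
  fromℕℚ (suc m) * stirlingPairing n m + 0ℚ
    ≡⟨ +-identityʳ _ ⟩
  fromℕℚ (suc m) * stirlingPairing n m ∎
  where
  open ≡-Reasoning
  E = expm1
  s = negOnePow
  M = suc m
  N = fromℕℚ (suc n)
  c : ℕ → ℕ → ℚ
  c l m = powS negLog1mt m l
  g : ℕ → ℚ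
  g l = fromℕℚ l * c l M * powS E l n
  g0≡0 : g 0 ≡ 0ℚ
  g0≡0 = trans (cong (_* powS E 0 n) (*-zeroˡ (c 0 M))) (*-zeroˡ (powS E 0 n))
  g[1+n]≡0 : g (suc n) ≡ 0ℚ
  g[1+n]≡0 = trans (cong (fromℕℚ (suc n) * c (suc n) M *_) (powS-vanishes-below E refl (ℕ.n<1+n n)))
                   (*-zeroʳ (fromℕℚ (suc n) * c (suc n) M))
  first-term-vanishes : N * (s (suc n) * c 0 M * powS E 0 (suc n)) ≡ 0ℚ
  first-term-vanishes =
    trans (cong (λ x → N * (s (suc n) * x * powS E 0 (suc n))) (powS-negLog1mt-0 m))
          (solve 3 (λ a b x → a :* (b :* con 0ℚ :* x) := con 0ℚ) refl N (s (suc n)) (powS E 0 (suc n)))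
  term : ∀ l → N * (s (n ∸ l) * c (suc l) M * powS E (suc l) (suc n))
             ≡ fromℕℚ (suc m) * (s (n ∸ l) * c l m * powS E l n) + s (n ∸ l) * (g l + g (suc l))
  term l = begin
    N * (σ * c (suc l) M * powS E (suc l) (suc n))
      ≡⟨ solve 4 (λ a b x y → a :* (b :* x :* y) := b :* x :* (a :* y)) refl N σ (c (suc l) M) (powS E (suc l) (suc n)) ⟩
    σ * c (suc l) M * deriv (powS E (suc l)) n
      ≡⟨ cong (σ * c (suc l) M *_) (deriv-powS-expm1 l n) ⟩
    σ * c (suc l) M * (fromℕℚ (suc l) * (powS E (suc l) n + powS E l n))
      ≡⟨ solve 5 (λ σ x f y z → σ :* x :* (f :* (y :+ z)) := σ :* (f :* x) :* z :+ σ :* (f :* x :* y))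
               refl σ (c (suc l) M) (fromℕℚ (suc l)) (powS E (suc l) n) (powS E l n) ⟩
    σ * (fromℕℚ (suc l) * c (suc l) M) * powS E l n + σ * g (suc l)
      ≡⟨ cong (λ x → σ * x * powS E l n + σ * g (suc l)) (powS-negLog1mt-recurrence l m) ⟩
    σ * (fromℕℚ M * c l m + fromℕℚ l * c l M) * powS E l n + σ * g (suc l)
      ≡⟨ solve 7 (λ σ a x f y e z → σ :* (a :* x :+ f :* y) :* e :+ σ :* z := a :* (σ :* x :* e) :+ σ :* (f :* y :* e :+ z))
               refl σ (fromℕℚ M) (c l m) (fromℕℚ l) (c l M) (powS E l n) (g (suc l)) ⟩
    fromℕℚ M * (σ * c l m * powS E l n) + σ * (g l + g (suc l)) ∎
    where σ = s (n ∸ l)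

stirling-orthogonality : ∀ n m → stirlingPairing n m ≡ kronecker n m
stirling-orthogonality zero    zero    = refl
stirling-orthogonality zero    (suc m) = trans (+-identityˡ _)
  (trans (cong (λ x → 1ℚ * x * powS expm1 0 0) (powS-negLog1mt-0 m)) (solve 1 (λ x → con 1ℚ :* con 0ℚ :* x := con 0ℚ) refl (powS expm1 0 0)))
stirling-orthogonality (suc n) zero    = trans (sumℚ-suc (suc n) _)
  (trans (cong₂ _+_ (*-zeroʳ (negOnePow (suc n) * 1ℚ))
                    (sumℚ-zero (suc n) (λ l _ → trans (cong (_* powS expm1 (suc l) (suc n)) (*-zeroʳ (negOnePow (n ∸ l))))
                                                      (*-zeroˡ (powS expm1 (suc l) (suc n))))))
         (+-identityʳ 0ℚ))
stirling-orthogonality (suc n) (suc m) = fromℕℚ-cancelˡ (suc n) (begin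
  fromℕℚ (suc n) * stirlingPairing (suc n) (suc m) ≡⟨ stirlingPairing-suc n m ⟩
  fromℕℚ (suc m) * stirlingPairing n m             ≡⟨ cong (fromℕℚ (suc m) *_) (stirling-orthogonality n m) ⟩
  fromℕℚ (suc m) * kronecker n m                   ≡⟨ kronecker-subst (λ i → fromℕℚ (suc i)) n m ⟩
  fromℕℚ (suc n) * kronecker n m                   ∎)
  where open ≡-Reasoning

powPS-separable : ∀ {y : PS} {a b : Ser} → (∀ i p → y i p ≡ a p * b i) →
                  ∀ m l j → powPS y m l j ≡ powS a m j * powS b m l
powPS-separable eq zero    zero    j = sym (*-identityʳ (oneS j))
powPS-separable eq zero    (suc l) j = sym (*-zeroʳ (oneS j))
powPS-separable {y} {a} {b} eq (suc m) l j = begin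
  sumℚ (suc l) (λ i → sumℚ (suc j) (λ p → y i p * powPS y m (l ∸ i) (j ∸ p)))
    ≡⟨ sumℚ-cong (suc l) (λ i → sumℚ-cong (suc j) (λ p →
         trans (cong₂ _*_ (eq i p) (powPS-separable eq m (l ∸ i) (j ∸ p)))
               (solve 4 (λ x u z w → x :* u :* (z :* w) := x :* z :* (u :* w)) refl (a p) (b i) (powS a m (j ∸ p)) (powS b m (l ∸ i))))) ⟩
  sumℚ (suc l) (λ i → sumℚ (suc j) (λ p → a p * powS a m (j ∸ p) * (b i * powS b m (l ∸ i))))
    ≡⟨ sumℚ-cong (suc l) (λ i → sym (sumℚ-* (suc j) (b i * powS b m (l ∸ i)) (λ p → a p * powS a m (j ∸ p)))) ⟩
  sumℚ (suc l) (λ i → powS a (suc m) j * (b i * powS b m (l ∸ i)))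
    ≡⟨ sym (*-sumℚ (suc l) (powS a (suc m) j) (λ i → b i * powS b m (l ∸ i))) ⟩
  powS a (suc m) j * powS b (suc m) l ∎
  where open ≡-Reasoning

negXLog1mt≡X*negLog1mt : ∀ i p → negXLog1mt i p ≡ X p * negLog1mt i
negXLog1mt≡X*negLog1mt zero    p = sym (*-zeroʳ (X p))
negXLog1mt≡X*negLog1mt (suc i) p = *-comm (recip (suc i)) (X p)

bel-zero : ∀ k j → bel k 0 j ≡ 0ℚ
bel-zero k j = solve 1 (λ x → con 1ℚ :* (con 0ℚ :+ con 0ℚ :* x) := con 0ℚ) refl (powPS negXLog1mt 0 0 j)

bel-expansion : ∀ k {l N} j → l ≤ N →
  bel k l j ≡ fromℕℚ (l !) * sumℚ (suc N) (λ m → liCoeff k m * powS X m j * powS negLog1mt m l)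
bel-expansion k {l} {N} j l≤N = cong (fromℕℚ (l !) *_) (begin
  sumℚ (suc l) (λ m → liCoeff k m * powPS negXLog1mt m l j)
    ≡⟨ sumℚ-cong (suc l) (λ m → trans (cong (liCoeff k m *_) (powPS-separable negXLog1mt≡X*negLog1mt m l j))
                                     (sym (*-assoc (liCoeff k m) _ _))) ⟩
  sumℚ (suc l) f
    ≡⟨ sumℚ-extend (suc l) (suc N) f vanish (s≤s l≤N) ⟩
  sumℚ (suc N) f ∎)
  where
  open ≡-Reasoning
  f : ℕ → ℚ
  f m = liCoeff k m * powS X m j * powS negLog1mt m l
  vanish : ∀ m → suc l ≤ m → m < suc N → f m ≡ 0ℚ
  vanish m l<m _ = trans (cong (liCoeff k m * powS X m j *_) (powS-vanishes-below negLog1mt refl l<m)) (*-zeroʳ (liCoeff k m * powS X m j))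

alternating-bel-sum : ∀ k n j →
  sumℚ n (λ i → negOnePow (n ∸ suc i) * bel k (suc i) j * S2 n (suc i)) ≡ fromℕℚ (n !) * (liCoeff k n * powS X n j)
alternating-bel-sum k n j = begin
  sumℚ n (λ i → T (suc i))
    ≡⟨ sym (trans (sumℚ-suc n T) (trans (cong (_+ sumℚ n (λ i → T (suc i))) T0≡0) (+-identityˡ _))) ⟩
  sumℚ (suc n) T
    ≡⟨ sumℚ-cong-< (suc n) (λ l l<1+n → term l (ℕ.≤-pred l<1+n)) ⟩
  sumℚ (suc n) (λ l → n! * sumℚ (suc n) (λ m → A m * (s (n ∸ l) * c l m * e l)))
    ≡⟨ sym (*-sumℚ (suc n) n! _) ⟩
  n! * sumℚ (suc n) (λ l → sumℚ (suc n) (λ m → A m * (s (n ∸ l) * c l m * e l)))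
    ≡⟨ cong (n! *_) (sumℚ-comm (suc n) (suc n) _) ⟩
  n! * sumℚ (suc n) (λ m → sumℚ (suc n) (λ l → A m * (s (n ∸ l) * c l m * e l)))
    ≡⟨ cong (n! *_) (sumℚ-cong (suc n) (λ m → trans (sym (*-sumℚ (suc n) (A m) _))
                                                   (cong (A m *_) (stirling-orthogonality n m)))) ⟩
  n! * sumℚ (suc n) (λ m → A m * kronecker n m)
    ≡⟨ cong (n! *_) (sumℚ-kronecker n A) ⟩
  n! * A n ∎
  where
  open ≡-Reasoning
  s = negOnePow
  n! = fromℕℚ (n !)
  A : ℕ → ℚ
  A m = liCoeff k m * powS X m j
  c : ℕ → ℕ → ℚ
  c l m = powS negLog1mt m l
  e : ℕ → ℚ
  e l = powS expm1 l n
  T : ℕ → ℚ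
  T l = s (n ∸ l) * bel k l j * S2 n l
  T0≡0 : T 0 ≡ 0ℚ
  T0≡0 = trans (cong (λ x → s n * x * S2 n 0) (bel-zero k j)) (solve 2 (λ a b → a :* con 0ℚ :* b := con 0ℚ) refl (s n) (S2 n 0))
  term : ∀ l → l ≤ n → T l ≡ n! * sumℚ (suc n) (λ m → A m * (s (n ∸ l) * c l m * e l))
  term l l≤n = begin
    s (n ∸ l) * bel k l j * (n! * (recip (l !) * e l))
      ≡⟨ cong (λ x → s (n ∸ l) * x * (n! * (recip (l !) * e l))) (bel-expansion k j l≤n) ⟩
    σ * (fromℕℚ (l !) * S) * (n! * (recip (l !) * e l))
      ≡⟨ solve 6 (λ σ f S N r e → σ :* (f :* S) :* (N :* (r :* e)) := N :* ((f :* r) :* (S :* (σ :* e)))) refl σ (fromℕℚ (l !)) S n! (recip (l !)) (e l) ⟩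
    n! * (fromℕℚ (l !) * recip (l !) * (S * (σ * e l)))
      ≡⟨ cong (λ x → n! * (x * (S * (σ * e l)))) (fromℕℚ*recip (l !) {{l ℕ.!≢0}}) ⟩
    n! * (1ℚ * (S * (σ * e l)))
      ≡⟨ cong (n! *_) (trans (*-identityˡ _) (sumℚ-* (suc n) (σ * e l) (λ m → A m * c l m))) ⟩
    n! * sumℚ (suc n) (λ m → A m * c l m * (σ * e l))
      ≡⟨ cong (n! *_) (sumℚ-cong (suc n) (λ m → solve 4 (λ a x σ y → a :* x :* (σ :* y) := a :* (σ :* x :* y)) refl (A m) (c l m) σ (e l))) ⟩
    n! * sumℚ (suc n) (λ m → A m * (σ * c l m * e l)) ∎
    where
    σ = s (n ∸ l)
    S = sumℚ (suc n) (λ m → A m * c l m)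

theorem9 : (k : ℤ) (n : ℕ) → 1 ≤ n → (j : ℕ) →
    powS X n j
      ≡ powZ n (k - + 1) * recip ((n ∸ 1) !)
          * sumℚ n (λ i → negOnePow (n ∸ suc i) * bel k (suc i) j * S2 n (suc i))
theorem9 k (suc n) _ j = sym (begin
  a * r * sumℚ (suc n) _                             ≡⟨ cong (a * r *_) (alternating-bel-sum k (suc n) j) ⟩
  a * r * (fromℕℚ (suc n ℕ.* n !) * (b * P))         ≡⟨ cong (λ x → a * r * (x * (b * P))) (fromℕℚ-* (suc n) (n !)) ⟩
  a * r * (fromℕℚ (suc n) * fromℕℚ (n !) * (b * P))  ≡⟨ solve 6 (λ a r N f b P → a :* r :* (N :* f :* (b :* P)) := (a :* b :* N) :* (f :* r) :* P)
                                                             refl a r (fromℕℚ (suc n)) (fromℕℚ (n !)) b P ⟩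
  (a * b * fromℕℚ (suc n)) * (fromℕℚ (n !) * r) * P  ≡⟨ cong₂ (λ x y → x * y * P) (powZ-pred*powZ-neg*base (suc n) k) (fromℕℚ*recip (n !) {{n ℕ.!≢0}}) ⟩
  1ℚ * 1ℚ * P                                        ≡⟨ solve 1 (λ P → con 1ℚ :* con 1ℚ :* P := P) refl P ⟩
  P                                                  ∎)
  where
  open ≡-Reasoning
  a = powZ (suc n) (k - + 1)
  b = powZ (suc n) (ℤ.- k)
  r = recip (n !)
  P = powS X (suc n) j
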